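{- Let $b,c,w_1$ be rational numbers such that $F(b,c)\neq 0$ and $Q_1(b,c)\neq 0$, such that $(b,c,w_1)$ lies on the surface $$D_1\,(w_1^2+3)^3+4\,(w_1-1)^2\,(1+w_1)^2=0,\qquad D_1=-\frac{P_1^2}{Q_1^3},$$ and such that $w_1\neq\pm 1$. Then there exists a rational number $\alpha_1$ such that $$w_1^2+3=Q_1\,\alpha_1^2,\qquad 2\,(w_1^2-1)=P_1\,\alpha_1^3 .$$
   Context: Define $F=b^2c^4-6b^2c^3+13b^2c^2-12b^2c+4b^2+c^2$, $$Q_1=\tfrac{3}{2}\,(2c^2+2b^4c^4-12b^4c^3+26b^4c^2-24b^4c+8b^4-6b^3c^4+18b^3c^3-36b^3c+24b^3+3b^2c^4+8b^2c^3-36b^2c^2+16b^2c+12b^2-6bc^3+12bc),$$ and $P_1=\dfrac{N_1}{2F}$, where $N_1=7812b^4c^4-216b^2c^4-52b^2c^3+1764b^3c^4-1200b^4c^3-1848b^4c^2+720b^4c-36bc^4-1512b^3c^3-36b^3c^8+288b^3c^2-108b^2c^6+380b^2c^5+378b^3c^7-231b^4c^8-300b^4c^7+3906b^4c^6-13b^2c^7-8904b^4c^5-882b^3c^6+18bc^6-1319b^6c^8+20952b^5c^3-11952b^5c^2+2592b^5c-48372b^6c^4+31620b^6c^3-10552b^6c^2+816b^6c+1494b^5c^8-5238b^5c^7-4c^5+7905b^6c^7-24186b^6c^6+288b^6+43740b^6c^5+7686b^5c^6+576b^7+128b^8-15372b^5c^4-1080b^7c^8-3546b^7c^6+51b^6c^9+400b^8c^8-162b^5c^9+8640b^7c^2-3456b^7c+2808b^7c^7-1560b^8c^7+3940b^8c^6+216b^7c^9-960b^8c-6240b^8c^3+9b^6c^{10}+7880b^8c^4+4b^8c^{10}-6732b^8c^5+45b^4c^9+3200b^8c^2-11232b^7c^3+7092b^7c^4-18b^7c^{10}-60b^8c^9$.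 These quantities arise in the study of rational perfect cuboids: the surface above parametrizes (via $b,c,w_1$) rational solutions of the cuboid factor equations. -}

module Defs where

open import Data.Nat using (ℕ; zero; suc)
open import Data.Integer as ℤ using (ℤ; +_)
open import Data.Rational using (ℚ; _+_; _*_; _-_; -_; _/_; 0ℚ; 1ℚ; NonZero; _÷_; 1/_; ½; ≢-nonZero)
open import Relation.Binary.PropositionalEquality using (_≢_)

infixr 8 _^_
_^_ : ℚ → ℕ → ℚ
q ^ zero  = 1ℚ
q ^ suc n = q * q ^ n

-ℤ_ : ℕ → ℤ
-ℤ n = ℤ.- (+ n)

κ : ℤ → ℚ
κ z = z / 1

module Poly (b c : ℚ) where
  t : ℤ → ℕ → ℕ → ℚ
  t z i j = κ z * b ^ i * c ^ j

  F : ℚ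
  F = t (+ 1) 2 4 + t (-ℤ 6) 2 3 + t (+ 13) 2 2 + t (-ℤ 12) 2 1 + t (+ 4) 2 0 + t (+ 1) 0 2

  Q₁ : ℚ
  Q₁ = ((+ 3) / 2) *
    ( t (+ 2) 0 2 + t (+ 2) 4 4 + t (-ℤ 12) 4 3 + t (+ 26) 4 2 + t (-ℤ 24) 4 1
    + t (+ 8) 4 0 + t (-ℤ 6) 3 4 + t (+ 18) 3 3 + t (-ℤ 36) 3 1 + t (+ 24) 3 0
    + t (+ 3) 2 4 + t (+ 8) 2 3 + t (-ℤ 36) 2 2 + t (+ 16) 2 1 + t (+ 12) 2 0
    + t (-ℤ 6) 1 3 + t (+ 12) 1 1 )

  N₁ : ℚ
  N₁ = t (+ 7812) 4 4
    + t (-ℤ 216) 2 4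
    + t (-ℤ 52) 2 3
    + t (+ 1764) 3 4
    + t (-ℤ 1200) 4 3
    + t (-ℤ 1848) 4 2
    + t (+ 720) 4 1
    + t (-ℤ 36) 1 4
    + t (-ℤ 1512) 3 3
    + t (-ℤ 36) 3 8
    + t (+ 288) 3 2
    + t (-ℤ 108) 2 6
    + t (+ 380) 2 5
    + t (+ 378) 3 7
    + t (-ℤ 231) 4 8
    + t (-ℤ 300) 4 7
    + t (+ 3906) 4 6
    + t (-ℤ 13) 2 7
    + t (-ℤ 8904) 4 5
    + t (-ℤ 882) 3 6
    + t (+ 18) 1 6
    + t (-ℤ 1319) 6 8
    + t (+ 20952) 5 3
    + t (-ℤ 11952) 5 2
    + t (+ 2592) 5 1
    + t (-ℤ 48372) 6 4
    + t (+ 31620) 6 3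
    + t (-ℤ 10552) 6 2
    + t (+ 816) 6 1
    + t (+ 1494) 5 8
    + t (-ℤ 5238) 5 7
    + t (-ℤ 4) 0 5
    + t (+ 7905) 6 7
    + t (-ℤ 24186) 6 6
    + t (+ 288) 6 0
    + t (+ 43740) 6 5
    + t (+ 7686) 5 6
    + t (+ 576) 7 0
    + t (+ 128) 8 0
    + t (-ℤ 15372) 5 4
    + t (-ℤ 1080) 7 8
    + t (-ℤ 3546) 7 6
    + t (+ 51) 6 9
    + t (+ 400) 8 8
    + t (-ℤ 162) 5 9
    + t (+ 8640) 7 2
    + t (-ℤ 3456) 7 1
    + t (+ 2808) 7 7
    + t (-ℤ 1560) 8 7
    + t (+ 3940) 8 6
    + t (+ 216) 7 9
    + t (-ℤ 960) 8 1
    + t (-ℤ 6240) 8 3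
    + t (+ 9) 6 10
    + t (+ 7880) 8 4
    + t (+ 4) 8 10
    + t (-ℤ 6732) 8 5
    + t (+ 45) 4 9
    + t (+ 3200) 8 2
    + t (-ℤ 11232) 7 3
    + t (+ 7092) 7 4
    + t (-ℤ 18) 7 10
    + t (-ℤ 60) 8 9

  P₁ : F ≢ 0ℚ → ℚ
  P₁ F≢0 = ½ * (N₁ ÷ F)
    where instance _ : NonZero F
                   _ = ≢-nonZero F≢0

  D₁ : F ≢ 0ℚ → Q₁ ≢ 0ℚ → ℚ
  D₁ F≢0 Q≢0 = - (P₁ F≢0 ^ 2 * (1/ Q₁) ^ 3)
    where instance _ : NonZero Q₁
                   _ = ≢-nonZero Q≢0

module Submission where

-- Write A = w₁² + 3 and B = 2(w₁² − 1).  Since 4(w₁ − 1)²(1 + w₁)² = B²,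
-- the surface equation  −(P₁²/Q₁³)·A³ + B² = 0  becomes, after clearing the
-- denominator,  B²·Q₁³ = P₁²·A³.  Any such relation with Q₁ ≠ 0 and B ≠ 0 is
-- solved by  α = B·Q₁ / (P₁·A):  then  Q₁α² = B²Q₁³/(P₁²A²) = A  and
-- Pα³ = B·B²Q₁³/(P₁²A³) = B.  The denominators P₁ and A are nonzero because
-- P₁²A³ = B²Q₁³ is a product of nonzero rationals, and B ≠ 0 exactly because
-- w₁ ≠ ±1.

open import Defs
open import Data.Integer using (+_)
open import Data.Nat using (ℕ; zero; suc)
open import Data.Rational using (ℚ; _+_; _*_; _-_; -_; _/_; 0ℚ; 1ℚ; 1/_; NonZero; ≢-nonZero)
open import Data.Rational.Properties
  using (1≢0; *-zeroˡ; *-zeroʳ; *-inverseʳ; +-0-group; heytingCommutativeRing)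
open import Data.Rational.Solver using (module +-*-Solver)
open import Algebra.Apartness.Properties.HeytingCommutativeRing heytingCommutativeRing
  using (x#0y#0→xy#0)
open import Algebra.Properties.Group +-0-group using (x∙y⁻¹≈ε⇒x≈y; inverseʳ-unique)
open import Data.Product using (∃; _×_; _,_)
open import Function using (_∘_)
open import Relation.Binary.PropositionalEquality
  using (_≡_; _≢_; refl; sym; cong; cong₂; subst; module ≡-Reasoning)
open +-*-Solver
open ≡-Reasoning

*-≢0 : ∀ {x y : ℚ} → x ≢ 0ℚ → y ≢ 0ℚ → x * y ≢ 0ℚ
*-≢0 = x#0y#0→xy#0

^-≢0 : ∀ {x : ℚ} (n : ℕ) → x ≢ 0ℚ → x ^ n ≢ 0ℚ
^-≢0 zero    x≢0 = 1≢0
^-≢0 (suc n) x≢0 = *-≢0 x≢0 (^-≢0 n x≢0)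

factorˡ-≢0 : ∀ x y → x * y ≢ 0ℚ → x ≢ 0ℚ
factorˡ-≢0 x y xy≢0 refl = xy≢0 (*-zeroˡ y)

factorʳ-≢0 : ∀ x y → x * y ≢ 0ℚ → y ≢ 0ℚ
factorʳ-≢0 x y xy≢0 refl = xy≢0 (*-zeroʳ x)

w²-1≢0 : ∀ w → w ≢ 1ℚ → w ≢ - 1ℚ → w ^ 2 - 1ℚ ≢ 0ℚ
w²-1≢0 w w≢1 w≢-1 =
  subst (_≢ 0ℚ) (sym factorisation)
        (*-≢0 (w≢1 ∘ x∙y⁻¹≈ε⇒x≈y w 1ℚ) (w≢-1 ∘ inverseʳ-unique 1ℚ w))
  where
  factorisation : w ^ 2 - 1ℚ ≡ (w - 1ℚ) * (1ℚ + w)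
  factorisation =
    solve 1 (λ w → w :^ 2 :- con 1ℚ := (w :- con 1ℚ) :* (con 1ℚ :+ w)) refl w

quartic-is-square : ∀ w →
  (+ 4 / 1) * (w - 1ℚ) ^ 2 * (1ℚ + w) ^ 2 ≡ ((+ 2 / 1) * (w ^ 2 - 1ℚ)) ^ 2
quartic-is-square = solve 1 (λ w →
  con (+ 4 / 1) :* (w :- con 1ℚ) :^ 2 :* (con 1ℚ :+ w) :^ 2
    := (con (+ 2 / 1) :* (w :^ 2 :- con 1ℚ)) :^ 2) refl

clear-denominator : ∀ P Q A E .{{_ : NonZero Q}} →
  - (P ^ 2 * (1/ Q) ^ 3) * A ^ 3 + E ≡ 0ℚ → E * Q ^ 3 ≡ P ^ 2 * A ^ 3
clear-denominator P Q A E surface = begin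
  E * Q ^ 3
    ≡⟨ solve 5 (λ P Q Q⁻¹ A E →
         E :* Q :^ 3
           := ((:- (P :^ 2 :* Q⁻¹ :^ 3)) :* A :^ 3 :+ E) :* Q :^ 3
              :+ P :^ 2 :* A :^ 3 :* (Q :* Q⁻¹) :^ 3) refl P Q (1/ Q) A E ⟩
  (- (P ^ 2 * (1/ Q) ^ 3) * A ^ 3 + E) * Q ^ 3 + P ^ 2 * A ^ 3 * (Q * 1/ Q) ^ 3
    ≡⟨ cong₂ (λ s u → s * Q ^ 3 + P ^ 2 * A ^ 3 * u ^ 3) surface (*-inverseʳ Q) ⟩
  0ℚ * Q ^ 3 + P ^ 2 * A ^ 3 * 1ℚ ^ 3
    ≡⟨ solve 3 (λ Q P A →
         con 0ℚ :* Q :^ 3 :+ P :^ 2 :* A :^ 3 :* con 1ℚ :^ 3 := P :^ 2 :* A :^ 3)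
         refl Q P A ⟩
  P ^ 2 * A ^ 3 ∎

square-cube-root : ∀ P Q A B → Q ≢ 0ℚ → B ≢ 0ℚ → B ^ 2 * Q ^ 3 ≡ P ^ 2 * A ^ 3 →
  ∃ λ α → A ≡ Q * α ^ 2 × B ≡ P * α ^ 3
square-cube-root P Q A B Q≢0 B≢0 relation = α , sym Qα²≡A , sym Pα³≡B
  where
  P²A³≢0 : P ^ 2 * A ^ 3 ≢ 0ℚ
  P²A³≢0 = subst (_≢ 0ℚ) relation (*-≢0 (^-≢0 2 B≢0) (^-≢0 3 Q≢0))

  instance
    P-nonZero : NonZero P
    P-nonZero = ≢-nonZero (factorˡ-≢0 P (P ^ 1) (factorˡ-≢0 (P ^ 2) (A ^ 3) P²A³≢0))
    A-nonZero : NonZero A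
    A-nonZero = ≢-nonZero (factorˡ-≢0 A (A ^ 2) (factorʳ-≢0 (P ^ 2) (A ^ 3) P²A³≢0))

  α : ℚ
  α = B * Q * 1/ P * 1/ A

  Qα²≡A : Q * α ^ 2 ≡ A
  Qα²≡A = begin
    Q * α ^ 2
      ≡⟨ solve 5 (λ B Q P⁻¹ A⁻¹ A →
           Q :* (B :* Q :* P⁻¹ :* A⁻¹) :^ 2 := B :^ 2 :* Q :^ 3 :* P⁻¹ :^ 2 :* A⁻¹ :^ 2)
           refl B Q (1/ P) (1/ A) A ⟩
    B ^ 2 * Q ^ 3 * (1/ P) ^ 2 * (1/ A) ^ 2
      ≡⟨ cong (λ x → x * (1/ P) ^ 2 * (1/ A) ^ 2) relation ⟩
    P ^ 2 * A ^ 3 * (1/ P) ^ 2 * (1/ A) ^ 2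
      ≡⟨ solve 4 (λ P P⁻¹ A A⁻¹ →
           P :^ 2 :* A :^ 3 :* P⁻¹ :^ 2 :* A⁻¹ :^ 2 := (P :* P⁻¹) :^ 2 :* (A :* A⁻¹) :^ 2 :* A)
           refl P (1/ P) A (1/ A) ⟩
    (P * 1/ P) ^ 2 * (A * 1/ A) ^ 2 * A
      ≡⟨ cong₂ (λ u v → u ^ 2 * v ^ 2 * A) (*-inverseʳ P) (*-inverseʳ A) ⟩
    1ℚ ^ 2 * 1ℚ ^ 2 * A
      ≡⟨ solve 1 (λ A → con 1ℚ :^ 2 :* con 1ℚ :^ 2 :* A := A) refl A ⟩
    A ∎

  Pα³≡B : P * α ^ 3 ≡ B
  Pα³≡B = begin
    P * α ^ 3
      ≡⟨ solve 5 (λ B Q P P⁻¹ A⁻¹ →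
           P :* (B :* Q :* P⁻¹ :* A⁻¹) :^ 3
             := B :* (B :^ 2 :* Q :^ 3) :* P :* P⁻¹ :^ 3 :* A⁻¹ :^ 3)
           refl B Q P (1/ P) (1/ A) ⟩
    B * (B ^ 2 * Q ^ 3) * P * (1/ P) ^ 3 * (1/ A) ^ 3
      ≡⟨ cong (λ x → B * x * P * (1/ P) ^ 3 * (1/ A) ^ 3) relation ⟩
    B * (P ^ 2 * A ^ 3) * P * (1/ P) ^ 3 * (1/ A) ^ 3
      ≡⟨ solve 5 (λ B P P⁻¹ A A⁻¹ →
           B :* (P :^ 2 :* A :^ 3) :* P :* P⁻¹ :^ 3 :* A⁻¹ :^ 3
             := B :* (P :* P⁻¹) :^ 3 :* (A :* A⁻¹) :^ 3)
           refl B P (1/ P) A (1/ A) ⟩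
    B * (P * 1/ P) ^ 3 * (A * 1/ A) ^ 3
      ≡⟨ cong₂ (λ u v → B * u ^ 3 * v ^ 3) (*-inverseʳ P) (*-inverseʳ A) ⟩
    B * 1ℚ ^ 3 * 1ℚ ^ 3
      ≡⟨ solve 1 (λ B → B :* con 1ℚ :^ 3 :* con 1ℚ :^ 3 := B) refl B ⟩
    B ∎

theorem2p1 : (b c w₁ : ℚ) →
    (F≢0 : Poly.F b c ≢ 0ℚ) →
    (Q≢0 : Poly.Q₁ b c ≢ 0ℚ) →
    Poly.D₁ b c F≢0 Q≢0 * (w₁ ^ 2 + (+ 3 / 1)) ^ 3
      + (+ 4 / 1) * (w₁ - 1ℚ) ^ 2 * (1ℚ + w₁) ^ 2 ≡ 0ℚ →
    w₁ ≢ 1ℚ →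
    w₁ ≢ - 1ℚ →
    ∃ λ (α₁ : ℚ) →
      (w₁ ^ 2 + (+ 3 / 1) ≡ Poly.Q₁ b c * α₁ ^ 2)
      × (+ 2 / 1) * (w₁ ^ 2 - 1ℚ) ≡ Poly.P₁ b c F≢0 * α₁ ^ 3
theorem2p1 b c w F≢0 Q≢0 surface w≢1 w≢-1 = square-cube-root P Q A B Q≢0 B≢0 B²Q³≡P²A³
  where
  Q P A B : ℚ
  Q = Poly.Q₁ b c
  P = Poly.P₁ b c F≢0
  A = w ^ 2 + (+ 3 / 1)
  B = (+ 2 / 1) * (w ^ 2 - 1ℚ)

  instance
    Q-nonZero : NonZero Q
    Q-nonZero = ≢-nonZero Q≢0

  B≢0 : B ≢ 0ℚ
  B≢0 = *-≢0 {x = + 2 / 1} (λ ()) (w²-1≢0 w w≢1 w≢-1)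

  -- D₁ unfolds to −P₁²·(1/Q₁)³, so the surface equation clears to B²Q₁³ = P₁²A³.
  B²Q³≡P²A³ : B ^ 2 * Q ^ 3 ≡ P ^ 2 * A ^ 3
  B²Q³≡P²A³ = begin
    B ^ 2 * Q ^ 3                                       ≡⟨ cong (_* Q ^ 3) (sym (quartic-is-square w)) ⟩
    (+ 4 / 1) * (w - 1ℚ) ^ 2 * (1ℚ + w) ^ 2 * Q ^ 3    ≡⟨ clear-denominator P Q A _ surface ⟩
    P ^ 2 * A ^ 3                                       ∎
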